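{- Let $A,B\in\mathbb{N}_m$ and $\underline{\alpha}=(\alpha_1,\dots,\alpha_s)$, $\underline{\beta}=(\beta_1,\dots,\beta_t)\in\mathbb{Z}^+_m$ with $R_{A,\underline{\alpha}}(n)=R_{B,\underline{\beta}}(n)$ for all $n\ge 0$. Let $u,v$ be integers such that $A+u$ and $B+v$ are multisets of nonnegative integers. Then $R_{A+u,\underline{\alpha}}(n)=R_{B+v,\underline{\beta}}(n)$ for all $n\ge0$ if and only if there exists $w\in\mathbb{N}$ such that \[u=w\frac{\beta_1+\cdots+\beta_t}{\gcd(\alpha_1+\cdots+\alpha_s,\ \beta_1+\cdots+\beta_t)},\qquad v=w\frac{\alpha_1+\cdots+\alpha_s}{\gcd(\alpha_1+\cdots+\alpha_s,\ \beta_1+\cdots+\beta_t)}.\]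
   Context: $\mathbb{N}=\{0,1,2,\dots\}$. A multiset $M$ of nonnegative integers is described by its multiplicity function $\chi_M$. $\mathbb{N}_m$ is the family of multisets $M$ of nonnegative integers with $\chi_M(0)=1$ and $\chi_M(n)<\infty$ for all $n\ge1$. $\mathbb{Z}^+_m$ is the set of finite vectors $(\alpha_1,\dots,\alpha_s)$ ($s\ge1$ arbitrary) of positive integers with $\alpha_1\le\cdots\le\alpha_s$. For $A=\{a_1\le a_2\le\cdots\}$ (listed with multiplicity), $R_{A,\underline{\alpha}}(n)=|\{(j_1,\dots,j_s): j_i\in\mathbb{Z}^+,\ \sum_i\alpha_i a_{j_i}=n\}|$. $A+u$ denotes the multiset $\{a+u: a\in A\}$ with the same multiplicities. -}

module Defs where

open import Data.Nat using (ℕ; zero; suc; _+_; _*_; _≤_; _<_; _≡ᵇ_)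
open import Data.Nat.DivMod using (_/_)
open import Data.Nat.GCD using (gcd)
open import Data.Bool using (if_then_else_)
open import Data.List using (List; []; _∷_; map; concatMap; upTo; zipWith; length)
open import Data.Nat.ListAction using (sum; product)
open import Data.List.Relation.Unary.All using (All)
open import Data.List.Relation.Unary.Linked using (Linked)
open import Data.Integer as ℤ using (ℤ; +_; -[1+_])
open import Data.Product using (_×_)
open import Relation.Binary.PropositionalEquality using (_≡_; _≢_)

-- A multiset of nonnegative integers with finite multiplicities is given
-- by its multiplicity function χ : ℕ → ℕ.
Multiset : Set
Multiset = ℕ → ℕ

-- Membership of the family ℕ_m: χ(0) = 1 (finiteness is automatic).
InNm : Multiset → Set
InNm χ = χ 0 ≡ 1

InZm : List ℕ → Set
InZm α = (α ≢ []) × All (0 <_) α × Linked _≤_ α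

tuples : ℕ → ℕ → List (List ℕ)
tuples zero    n = [] ∷ []
tuples (suc s) n = concatMap (λ m → map (m ∷_) (tuples s n)) (upTo (suc n))

weighted : List ℕ → List ℕ → ℕ
weighted α ms = sum (zipWith _*_ α ms)

-- R_{A,α}(n): number of index tuples (j_1,…,j_s) with Σ α_i a_{j_i} = n.
-- Grouping index tuples by the tuple of values (m_1,…,m_s) = (a_{j_1},…,a_{j_s}),
-- each value tuple contributes Π χ(m_i) index tuples.  Since every α_i ≥ 1,
-- each m_i ≤ n, so it suffices to range over {0,…,n}^s.
R : Multiset → List ℕ → ℕ → ℕ
R χ α n = sum (map (λ ms → if weighted α ms ≡ᵇ n then product (map χ ms) else 0)
                   (tuples (length α) n))

χℤ : Multiset → ℤ → ℕ
χℤ χ (+ m)    = χ m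
χℤ χ -[1+ _ ] = 0

shift : Multiset → ℤ → Multiset
shift χ u n = χℤ χ ((+ n) ℤ.- u)

ShiftNonneg : Multiset → ℤ → Set
ShiftNonneg χ u = ∀ a → 0 < χ a → + 0 ℤ.≤ (+ a) ℤ.+ u

-- Natural division x / d (d = 0 gives 0; only used with d = gcd ≥ 1).
_div_ : ℕ → ℕ → ℕ
x div zero    = 0
x div (suc d) = x / suc d

-- A value tuple (m₁,…,m_s) contributes to R_{A+u,α}(n) exactly when it is (u,…,u) plus a tuple
-- contributing to R_{A,α}(n − uΣα), so R_{A+u,α} is R_{A,α} delayed by uΣα.  As R_{A,α}(0) = 1,
-- the shifted representation functions agree iff they start at the same place, i.e. uΣα = vΣβ,
-- and the solutions of this equation are the multiples stated, because Σα/g and Σβ/g are coprime.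
module Submission where

open import Defs
open import Data.Nat as ℕ using (ℕ)
open import Data.Nat.GCD using (gcd)
open import Data.List using (List)
open import Data.Nat.ListAction using (sum)
open import Data.Integer using (ℤ; +_)
open import Data.Product using (_×_; ∃-syntax)
open import Function.Bundles using (_⇔_)
open import Relation.Binary.PropositionalEquality using (_≡_)

open import Data.Bool using (true; false; if_then_else_)
open import Data.Empty using (⊥-elim)
open import Data.Integer using (-[1+_]; -_)
import Data.Integer.Properties as ℤ
open import Data.List using ([]; _∷_; map; concatMap; upTo; applyUpTo; length; _++_)
open import Data.List.Properties using (map-++; map-∘; map-cong; map-upTo)
open import Data.List.Relation.Unary.All using (All; []; _∷_)
open import Data.Nat using (zero; suc; _+_; _*_; _∸_; _≤_; _<_; _≡ᵇ_; z<s; s<s; NonZero; ≢-nonZero; ≢-nonZero⁻¹; >-nonZero)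
open import Data.Nat.Coprimality using (Coprime; coprime-/gcd; coprime-divisor)
open import Data.Nat.Divisibility using (_∣_; divides)
open import Data.Nat.DivMod using (_/_; m/n*n≡m)
open import Data.Nat.GCD using (gcd[m,n]∣m; gcd[m,n]∣n; gcd[m,n]≢0; m/gcd[m,n]≢0)
open import Data.Nat.ListAction using (product)
open import Data.Nat.ListAction.Properties using (sum-++)
open import Data.Nat.Properties
open import Algebra.Properties.CommutativeSemigroup *-commutativeSemigroup using (xy∙z≈xz∙y)
open import Data.Nat.Tactic.RingSolver using (solve-∀)
open import Data.Product using (_,_; map₂) renaming (map to ×-map)
open import Data.Sum using (inj₁)
open import Function using (_∘_)
open import Function.Bundles using (mk⇔)
open import Function.Properties.Equivalence using () renaming (trans to ⇔-trans)
open import Relation.Binary.PropositionalEquality using (_≢_; refl; sym; trans; cong; cong₂; subst; module ≡-Reasoning)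
open import Relation.Nullary using (¬_; yes; no)

sumBelow : ℕ → (ℕ → ℕ) → ℕ
sumBelow zero    f = 0
sumBelow (suc N) f = f 0 + sumBelow N (f ∘ suc)

sum-applyUpTo : ∀ f N → sum (applyUpTo f N) ≡ sumBelow N f
sum-applyUpTo f zero    = refl
sum-applyUpTo f (suc N) = cong (_+_ (f 0)) (sum-applyUpTo (f ∘ suc) N)

sumBelow-cong : ∀ N {f g} → (∀ m → m < N → f m ≡ g m) → sumBelow N f ≡ sumBelow N g
sumBelow-cong zero    _   = refl
sumBelow-cong (suc N) f≡g = cong₂ _+_ (f≡g 0 z<s) (sumBelow-cong N (λ m m<N → f≡g (suc m) (s<s m<N)))

sumBelow-zero : ∀ N {f} → (∀ m → m < N → f m ≡ 0) → sumBelow N f ≡ 0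
sumBelow-zero zero    _   = refl
sumBelow-zero (suc N) f≡0 rewrite f≡0 0 z<s = sumBelow-zero N (λ m m<N → f≡0 (suc m) (s<s m<N))

sumBelow-+ : ∀ M N f → sumBelow (M + N) f ≡ sumBelow M f + sumBelow N (λ k → f (M + k))
sumBelow-+ zero    N f = refl
sumBelow-+ (suc M) N f = trans (cong (_+_ (f 0)) (sumBelow-+ M N (f ∘ suc))) (sym (+-assoc (f 0) _ _))

sumBelow-extend : ∀ M N {f} → (∀ k → f (M + k) ≡ 0) → sumBelow (M + N) f ≡ sumBelow M f
sumBelow-extend M N {f} tail≡0 = begin
  sumBelow (M + N) f                             ≡⟨ sumBelow-+ M N f ⟩
  sumBelow M f + sumBelow N (λ k → f (M + k))    ≡⟨ cong (_+_ (sumBelow M f)) (sumBelow-zero N (λ k _ → tail≡0 k)) ⟩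
  sumBelow M f + 0                               ≡⟨ +-identityʳ _ ⟩
  sumBelow M f                                   ∎
  where open ≡-Reasoning

sumBelow-delay : ∀ u N {f g} → (∀ m → m < u → f m ≡ 0) → (∀ k → f (u + k) ≡ g k) →
                 (∀ k → N ≤ u + k → g k ≡ 0) → sumBelow N f ≡ sumBelow N g
sumBelow-delay u N {f} {g} head≡0 f≡g tail≡0 with u ≤? N
... | no u≰N = trans (sumBelow-zero N (λ m m<N → head≡0 m (<-trans m<N N<u)))
                     (sym (sumBelow-zero N (λ k _ → tail≡0 k (≤-trans (<⇒≤ N<u) (m≤m+n u k)))))
  where N<u = ≰⇒> u≰N
... | yes u≤N = begin
  sumBelow N f                                   ≡⟨ cong (λ L → sumBelow L f) (sym u+K≡N) ⟩
  sumBelow (u + K) f                             ≡⟨ sumBelow-+ u K f ⟩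
  sumBelow u f + sumBelow K (λ k → f (u + k))    ≡⟨ cong₂ _+_ (sumBelow-zero u head≡0) (sumBelow-cong K (λ k _ → f≡g k)) ⟩
  sumBelow K g                                   ≡⟨ sumBelow-extend K u (λ j → tail≡0 (K + j) (N≤u+K+j j)) ⟨
  sumBelow (K + u) g                             ≡⟨ cong (λ L → sumBelow L g) (trans (+-comm K u) u+K≡N) ⟩
  sumBelow N g                                   ∎
  where
  open ≡-Reasoning
  K = N ∸ u
  u+K≡N : u + K ≡ N
  u+K≡N = m+[n∸m]≡n u≤N
  N≤u+K+j : ∀ j → N ≤ u + (K + j)
  N≤u+K+j j = ≤-trans (≤-reflexive (sym u+K≡N)) (+-monoʳ-≤ u (m≤m+n K j))

sum-map-concatMap : ∀ {A B : Set} (h : B → ℕ) (k : A → List B) xs →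
                    sum (map h (concatMap k xs)) ≡ sum (map (λ x → sum (map h (k x))) xs)
sum-map-concatMap h k []       = refl
sum-map-concatMap h k (x ∷ xs) = begin
  sum (map h (k x ++ concatMap k xs))                ≡⟨ cong sum (map-++ h (k x) (concatMap k xs)) ⟩
  sum (map h (k x) ++ map h (concatMap k xs))        ≡⟨ sum-++ (map h (k x)) _ ⟩
  sum (map h (k x)) + sum (map h (concatMap k xs))   ≡⟨ cong (_+_ (sum (map h (k x)))) (sum-map-concatMap h k xs) ⟩
  sum (map h (k x)) + sum (map (λ x → sum (map h (k x))) xs) ∎
  where open ≡-Reasoning

sum-map-*ˡ : ∀ {A : Set} k (f : A → ℕ) xs → sum (map (λ x → k * f x) xs) ≡ k * sum (map f xs)
sum-map-*ˡ k f []       = sym (*-zeroʳ k)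
sum-map-*ˡ k f (x ∷ xs) = trans (cong (_+_ (k * f x)) (sum-map-*ˡ k f xs)) (sym (*-distribˡ-+ k (f x) _))

if-*ˡ : ∀ b x y → (if b then x * y else 0) ≡ x * (if b then y else 0)
if-*ˡ true  x y = refl
if-*ˡ false x y = sym (*-zeroʳ x)

-- count χ α c n is R χ α n with the weighted sum started at c instead of 0; letting each
-- variable range over 0,…,n mirrors the definition of R.
count : Multiset → List ℕ → ℕ → ℕ → ℕ
count χ []      c n = if c ≡ᵇ n then 1 else 0
count χ (a ∷ α) c n = sumBelow (suc n) (λ m → χ m * count χ α (c + a * m) n)

tuples-sum≡count : ∀ χ α c n →
  sum (map (λ ms → if c + weighted α ms ≡ᵇ n then product (map χ ms) else 0) (tuples (length α) n))
    ≡ count χ α c n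
tuples-sum≡count χ []      c n rewrite +-identityʳ c = +-identityʳ _
tuples-sum≡count χ (a ∷ α) c n = begin
  sum (map term (concatMap (λ m → map (m ∷_) T) (upTo (suc n))))
    ≡⟨ sum-map-concatMap term (λ m → map (m ∷_) T) (upTo (suc n)) ⟩
  sum (map (λ m → sum (map term (map (m ∷_) T))) (upTo (suc n)))
    ≡⟨ cong sum (map-cong first-variable (upTo (suc n))) ⟩
  sum (map f (upTo (suc n)))
    ≡⟨ cong sum (map-upTo f (suc n)) ⟩
  sum (applyUpTo f (suc n))
    ≡⟨ sum-applyUpTo f (suc n) ⟩
  count χ (a ∷ α) c n ∎
  where
  open ≡-Reasoning
  T = tuples (length α) n
  term = λ ms → if c + weighted (a ∷ α) ms ≡ᵇ n then product (map χ ms) else 0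
  term′ = λ m ms → if c + a * m + weighted α ms ≡ᵇ n then product (map χ ms) else 0
  f = λ m → χ m * count χ α (c + a * m) n
  term-∷ : ∀ m ms → term (m ∷ ms) ≡ χ m * term′ m ms
  term-∷ m ms = trans (cong (λ x → if x ≡ᵇ n then χ m * product (map χ ms) else 0) (sym (+-assoc c (a * m) _)))
                      (if-*ˡ _ (χ m) _)
  first-variable : ∀ m → sum (map term (map (m ∷_) T)) ≡ f m
  first-variable m = begin
    sum (map term (map (m ∷_) T))           ≡⟨ cong sum (map-∘ T) ⟨
    sum (map (term ∘ (m ∷_)) T)             ≡⟨ cong sum (map-cong (term-∷ m) T) ⟩
    sum (map (λ ms → χ m * term′ m ms) T)   ≡⟨ sum-map-*ˡ (χ m) (term′ m) T ⟩
    χ m * sum (map (term′ m) T)             ≡⟨ cong (χ m *_) (tuples-sum≡count χ α (c + a * m) n) ⟩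
    f m                                     ∎

R≡count : ∀ χ α n → R χ α n ≡ count χ α 0 n
R≡count χ α n = tuples-sum≡count χ α 0 n

<⇒≡ᵇ-false : ∀ {m n} → n < m → (m ≡ᵇ n) ≡ false
<⇒≡ᵇ-false {suc m} {zero}  _         = refl
<⇒≡ᵇ-false {suc m} {suc n} (s<s n<m) = <⇒≡ᵇ-false n<m

n<m⇒n<c+a*m : ∀ c {a m n} → 0 < a → n < m → n < c + a * m
n<m⇒n<c+a*m c {a} {m} 0<a n<m = <-≤-trans n<m (≤-trans (m≤n*m m a) (m≤n+m (a * m) c))
  where instance _ = >-nonZero 0<a

count-beyond : ∀ χ α {c n} → n < c → count χ α c n ≡ 0
count-beyond χ []      n<c rewrite <⇒≡ᵇ-false n<c = refl
count-beyond χ (a ∷ α) {c} {n} n<c = sumBelow-zero (suc n) (λ m _ →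
  trans (cong (χ m *_) (count-beyond χ α (<-≤-trans n<c (m≤m+n c (a * m))))) (*-zeroʳ (χ m)))

*-count-beyond : ∀ χ α x {c n} → n < c → x * count χ α c n ≡ 0
*-count-beyond χ α x n<c = trans (cong (x *_) (count-beyond χ α n<c)) (*-zeroʳ x)

count-origin : ∀ {χ} → InNm χ → ∀ α → count χ α 0 0 ≡ 1
count-origin χ0≡1 []      = refl
count-origin {χ} χ0≡1 (a ∷ α) rewrite *-zeroʳ a | count-origin {χ} χ0≡1 α | χ0≡1 = refl

count-translate : ∀ χ α → All (0 <_) α → ∀ d c n → count χ α (d + c) (d + n) ≡ count χ α c n
count-translate χ []      _           zero    c n = refl
count-translate χ []      _           (suc d) c n = count-translate χ [] [] d c n
count-translate χ (a ∷ α) (0<a ∷ 0<α) d       c n = begin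
  sumBelow (suc (d + n)) g    ≡⟨ sumBelow-cong (suc (d + n)) (λ m _ → cong (χ m *_) (step m)) ⟩
  sumBelow (suc (d + n)) f    ≡⟨ cong (λ L → sumBelow (suc L) f) (+-comm d n) ⟩
  sumBelow (suc n + d) f      ≡⟨ sumBelow-extend (suc n) d {f} (λ k →
                                   *-count-beyond χ α (χ (suc n + k)) (n<m⇒n<c+a*m c 0<a (m≤m+n (suc n) k))) ⟩
  sumBelow (suc n) f          ∎
  where
  open ≡-Reasoning
  f = λ m → χ m * count χ α (c + a * m) n
  g = λ m → χ m * count χ α (d + c + a * m) (d + n)
  step : ∀ m → count χ α (d + c + a * m) (d + n) ≡ count χ α (c + a * m) n
  step m = trans (cong (λ x → count χ α x (d + n)) (+-assoc d c (a * m)))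
                 (count-translate χ α 0<α d (c + a * m) n)

count≡R∸ : ∀ χ α → All (0 <_) α → ∀ {c n} → c ≤ n → count χ α c n ≡ R χ α (n ∸ c)
count≡R∸ χ α 0<α {c} {n} c≤n = begin
  count χ α c n                   ≡⟨ cong₂ (count χ α) (+-identityʳ c) (m+[n∸m]≡n c≤n) ⟨
  count χ α (c + 0) (c + (n ∸ c)) ≡⟨ count-translate χ α 0<α c 0 (n ∸ c) ⟩
  count χ α 0 (n ∸ c)             ≡⟨ R≡count χ α (n ∸ c) ⟨
  R χ α (n ∸ c)                   ∎
  where open ≡-Reasoning

χℤ-negative : ∀ χ {x} → 0 < x → χℤ χ (- (+ x)) ≡ 0
χℤ-negative χ {suc x} _ = refl

shift-< : ∀ χ {u m} → m < u → shift χ (+ u) m ≡ 0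
shift-< χ {u} {m} m<u = trans (cong (χℤ χ) (trans (ℤ.m-n≡m⊖n m u) (ℤ.⊖-< m<u)))
                              (χℤ-negative χ (m<n⇒0<n∸m m<u))

shift-+ : ∀ χ u k → shift χ (+ u) (u + k) ≡ χ k
shift-+ χ u k = cong (χℤ χ) (trans (ℤ.m-n≡m⊖n (u + k) u)
                              (trans (ℤ.⊖-≥ (m≤m+n u k)) (cong +_ (m+n∸m≡n u k))))

count-shift : ∀ χ u α → All (0 <_) α → ∀ c n → count (shift χ (+ u)) α c n ≡ count χ α (c + u * sum α) n
count-shift χ u []      _           c n rewrite *-zeroʳ u | +-identityʳ c = refl
count-shift χ u (a ∷ α) (0<a ∷ 0<α) c n =
  sumBelow-delay u (suc n) {f} {g} below-u reindex vanish
  where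
  S = a + sum α
  f = λ m → shift χ (+ u) m * count (shift χ (+ u)) α (c + a * m) n
  g = λ k → χ k * count χ α (c + u * S + a * k) n
  instance
    _ = >-nonZero 0<a
    _ = >-nonZero (≤-trans 0<a (m≤m+n a (sum α)))
  below-u : ∀ m → m < u → f m ≡ 0
  below-u m m<u = cong (_* count (shift χ (+ u)) α (c + a * m) n) (shift-< χ m<u)
  regroup : ∀ c a u k s → c + a * (u + k) + u * s ≡ c + u * (a + s) + a * k
  regroup = solve-∀
  reindex : ∀ k → f (u + k) ≡ g k
  reindex k = cong₂ _*_ (shift-+ χ u k)
    (trans (count-shift χ u α 0<α (c + a * (u + k)) n)
           (cong (λ x → count χ α x n) (regroup c a u k (sum α))))
  vanish : ∀ k → suc n ≤ u + k → g k ≡ 0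
  vanish k n<u+k = *-count-beyond χ α (χ k) (<-≤-trans n<u+k u+k≤)
    where
    u+k≤ : u + k ≤ c + u * S + a * k
    u+k≤ = +-mono-≤ (≤-trans (m≤m*n u S) (m≤n+m (u * S) c)) (m≤n*m k a)

R-shift-< : ∀ χ u α → All (0 <_) α → ∀ {n} → n < u * sum α → R (shift χ (+ u)) α n ≡ 0
R-shift-< χ u α 0<α {n} n<p = trans (R≡count _ α n)
  (trans (count-shift χ u α 0<α 0 n) (count-beyond χ α n<p))

R-shift-≥ : ∀ χ u α → All (0 <_) α → ∀ {n} → u * sum α ≤ n →
            R (shift χ (+ u)) α n ≡ R χ α (n ∸ u * sum α)
R-shift-≥ χ u α 0<α {n} p≤n = trans (R≡count _ α n)
  (trans (count-shift χ u α 0<α 0 n) (count≡R∸ χ α 0<α p≤n))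

R-shift-onset : ∀ {χ} → InNm χ → ∀ u α → All (0 <_) α → R (shift χ (+ u)) α (u * sum α) ≡ 1
R-shift-onset {χ} χ0≡1 u α 0<α = begin
  R (shift χ (+ u)) α (u * sum α)  ≡⟨ R-shift-≥ χ u α 0<α ≤-refl ⟩
  R χ α (u * sum α ∸ u * sum α)    ≡⟨ cong (R χ α) (n∸n≡0 (u * sum α)) ⟩
  R χ α 0                          ≡⟨ R≡count χ α 0 ⟩
  count χ α 0 0                    ≡⟨ count-origin χ0≡1 α ⟩
  1                                ∎
  where open ≡-Reasoning

least-nonzero-unique : ∀ {f g : ℕ → ℕ} {p q} → (∀ n → f n ≡ g n) →
                       (∀ n → n < p → f n ≡ 0) → f p ≢ 0 →
                       (∀ n → n < q → g n ≡ 0) → g q ≢ 0 → p ≡ q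
least-nonzero-unique f≗g f<p fp≢0 g<q gq≢0 = ≤-antisym
  (≮⇒≥ λ q<p → gq≢0 (trans (sym (f≗g _)) (f<p _ q<p)))
  (≮⇒≥ λ p<q → fp≢0 (trans (f≗g _) (g<q _ p<q)))

shifts-agree⇔ : ∀ {A B α β} → InNm A → InNm B → All (0 <_) α → All (0 <_) β →
                (∀ n → R A α n ≡ R B β n) → ∀ u v →
                (∀ n → R (shift A (+ u)) α n ≡ R (shift B (+ v)) β n) ⇔ (u * sum α ≡ v * sum β)
shifts-agree⇔ {A} {B} {α} {β} A0≡1 B0≡1 0<α 0<β R≡ u v = mk⇔ to from
  where
  to : (∀ n → R (shift A (+ u)) α n ≡ R (shift B (+ v)) β n) → u * sum α ≡ v * sum β
  to shifted≡ = least-nonzero-unique shifted≡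
    (λ _ → R-shift-< A u α 0<α) (1+n≢0 ∘ trans (sym (R-shift-onset A0≡1 u α 0<α)))
    (λ _ → R-shift-< B v β 0<β) (1+n≢0 ∘ trans (sym (R-shift-onset B0≡1 v β 0<β)))
  from : u * sum α ≡ v * sum β → ∀ n → R (shift A (+ u)) α n ≡ R (shift B (+ v)) β n
  from p≡q n with u * sum α ≤? n
  ... | yes p≤n = begin
    R (shift A (+ u)) α n   ≡⟨ R-shift-≥ A u α 0<α p≤n ⟩
    R A α (n ∸ u * sum α)   ≡⟨ R≡ (n ∸ u * sum α) ⟩
    R B β (n ∸ u * sum α)   ≡⟨ cong (λ p → R B β (n ∸ p)) p≡q ⟩
    R B β (n ∸ v * sum β)   ≡⟨ R-shift-≥ B v β 0<β (subst (_≤ n) p≡q p≤n) ⟨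
    R (shift B (+ v)) β n   ∎
    where open ≡-Reasoning
  ... | no p≰n = trans (R-shift-< A u α 0<α (≰⇒> p≰n))
                       (sym (R-shift-< B v β 0<β (subst (n <_) p≡q (≰⇒> p≰n))))

div≡/ : ∀ x d .{{_ : NonZero d}} → x div d ≡ x / d
div≡/ x (suc d) = refl

*-/-*-cancel : ∀ u {a d} .{{_ : NonZero d}} → d ∣ a → u * (a / d) * d ≡ u * a
*-/-*-cancel u {a} {d} d∣a = trans (*-assoc u (a / d) d) (cong (u *_) (m/n*n≡m d∣a))

coprime-proportional : ∀ {a b u v} → Coprime a b → .{{_ : NonZero a}} → u * a ≡ v * b →
                       ∃[ w ] (u ≡ w * b × v ≡ w * a)
coprime-proportional {a} {b} {u} {v} a⊥b ua≡vb
  with coprime-divisor a⊥b (divides u (trans (*-comm b v) (sym ua≡vb)))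
... | divides w v≡wa = w , *-cancelʳ-≡ u (w * b) a ua≡wba , v≡wa
  where
  ua≡wba : u * a ≡ w * b * a
  ua≡wba = trans ua≡vb (trans (cong (_* b) v≡wa) (xy∙z≈xz∙y w a b))

gcd-nonZeroˡ : ∀ a b .{{_ : NonZero a}} → NonZero (gcd a b)
gcd-nonZeroˡ a b = ≢-nonZero (gcd[m,n]≢0 a b (inj₁ (≢-nonZero⁻¹ a)))

proportional⇔multiple : ∀ a b {u v} .{{_ : NonZero a}} →
  (u * a ≡ v * b) ⇔ (∃[ w ] (u ≡ w * (b div gcd a b) × v ≡ w * (a div gcd a b)))
proportional⇔multiple a b {u} {v}
  rewrite div≡/ a (gcd a b) {{gcd-nonZeroˡ a b}} | div≡/ b (gcd a b) {{gcd-nonZeroˡ a b}} = mk⇔ to from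
  where
  instance _ = gcd-nonZeroˡ a b
  g = gcd a b
  a′ = a / g
  b′ = b / g
  instance _ = ≢-nonZero (m/gcd[m,n]≢0 a b)
  to : u * a ≡ v * b → ∃[ w ] (u ≡ w * b′ × v ≡ w * a′)
  to ua≡vb = coprime-proportional (coprime-/gcd a b) (*-cancelʳ-≡ (u * a′) (v * b′) g (begin
    u * a′ * g   ≡⟨ *-/-*-cancel u (gcd[m,n]∣m a b) ⟩
    u * a        ≡⟨ ua≡vb ⟩
    v * b        ≡⟨ *-/-*-cancel v (gcd[m,n]∣n a b) ⟨
    v * b′ * g   ∎))
    where open ≡-Reasoning
  from : ∃[ w ] (u ≡ w * b′ × v ≡ w * a′) → u * a ≡ v * b
  from (w , u≡wb′ , v≡wa′) = begin
    u * a              ≡⟨ *-/-*-cancel u (gcd[m,n]∣m a b) ⟨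
    u * a′ * g         ≡⟨ cong (λ x → x * a′ * g) u≡wb′ ⟩
    w * b′ * a′ * g    ≡⟨ cong (_* g) (xy∙z≈xz∙y w b′ a′) ⟩
    w * a′ * b′ * g    ≡⟨ cong (λ x → x * b′ * g) v≡wa′ ⟨
    v * b′ * g         ≡⟨ *-/-*-cancel v (gcd[m,n]∣n a b) ⟩
    v * b              ∎
    where open ≡-Reasoning

sum-nonZero : ∀ {α} → α ≢ [] → All (0 <_) α → NonZero (sum α)
sum-nonZero {[]}    α≢[] _         = ⊥-elim (α≢[] refl)
sum-nonZero {a ∷ α} _    (0<a ∷ _) = >-nonZero (≤-trans 0<a (m≤m+n a (sum α)))

negative-shift : ∀ {χ k} → InNm χ → ¬ ShiftNonneg χ -[1+ k ]
negative-shift χ0≡1 nonneg with nonneg 0 (subst (0 <_) (sym χ0≡1) z<s)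
... | ()

corollary1p5 : (A B : Multiset) → InNm A → InNm B →
    (α β : List ℕ) → InZm α → InZm β →
    (∀ n → R A α n ≡ R B β n) →
    (u v : ℤ) → ShiftNonneg A u → ShiftNonneg B v →
    ((∀ n → R (shift A u) α n ≡ R (shift B v) β n) ⇔
     (∃[ w ] ((u ≡ + (w ℕ.* (sum β div gcd (sum α) (sum β)))) ×
              (v ≡ + (w ℕ.* (sum α div gcd (sum α) (sum β)))))))
corollary1p5 A B A0≡1 B0≡1 α β (α≢[] , 0<α , _) (_ , 0<β , _) R≡ (+ u) (+ v) _ _ =
  ⇔-trans (shifts-agree⇔ A0≡1 B0≡1 0<α 0<β R≡ u v)
  (⇔-trans (proportional⇔multiple (sum α) (sum β) {{sum-nonZero α≢[] 0<α}})
           (mk⇔ (map₂ (×-map (cong (λ x → + x)) (cong (λ x → + x)))) (map₂ (×-map ℤ.+-injective ℤ.+-injective))))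
corollary1p5 A B A0≡1 B0≡1 α β _ _ _ -[1+ _ ] v     A+u≥0 _     = ⊥-elim (negative-shift A0≡1 A+u≥0)
corollary1p5 A B A0≡1 B0≡1 α β _ _ _ (+ u) -[1+ _ ] _     B+v≥0 = ⊥-elim (negative-shift B0≡1 B+v≥0)
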